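{- Let $m\ge 0$ and $n$ be integers with $m\le n-3$, and let $\mathcal{F}$ be a family of at most $n-1$ pairwise disjoint vertex sets of $Q_n$, each of which is a $k$-subcube of $Q_n$ for some $0\le k\le m$. Let $\mathbf{u},\mathbf{v}$ be two symmetric vertices of $Q_n$, neither lying in $\bigcup\mathcal{F}$. Then there exists $j\in\{1,2,\ldots,n\}$ such that neither $(\mathbf{u})^j$ nor $(\mathbf{v})^j$ lies in $\bigcup\mathcal{F}$.
   Context: The $n$-dimensional hypercube $Q_n$ is the graph whose vertices are the binary strings $x_1\cdots x_n$, two vertices being adjacent iff they differ in exactly one position. For a vertex $\mathbf{x}$ and $1\le j\le n$, $(\mathbf{x})^j$ denotes the vertex differing from $\mathbf{x}$ exactly in position $j$. Two vertices are symmetric if they differ in all $n$ positions. For $0\le k\le n$, a $k$-subcube of $Q_n$ is a vertex set whose induced subgraph is isomorphic to $Q_k$ ($Q_0$ being a single vertex). -}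

module Defs where

open import Data.Bool using (Bool; not)
open import Data.Nat using (ℕ; _≤_)
open import Data.Fin using (Fin)
open import Data.Vec using (Vec; lookup; updateAt)
open import Data.List using (List; length)
import Data.List
import Data.Empty
open import Data.List.Relation.Unary.All using (All)
open import Data.List.Relation.Unary.Any using (Any)
open import Data.Product using (Σ; ∃; ∃-syntax; _×_)
open import Relation.Binary.PropositionalEquality using (_≡_; _≢_)
open import Relation.Nullary using (¬_)
open import Function.Bundles using (_⇔_)
open import Function.Definitions using (Injective)

Vertex : ℕ → Set
Vertex n = Vec Bool n

Adj : ∀ {n} → Vertex n → Vertex n → Set
Adj {n} x y = ∃[ i ] (lookup x i ≢ lookup y i × (∀ (j : Fin n) → j ≢ i → lookup x j ≡ lookup y j))

flip : ∀ {n} → Vertex n → Fin n → Vertex n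
flip x j = updateAt x j not

Symmetric : ∀ {n} → Vertex n → Vertex n → Set
Symmetric {n} x y = ∀ (i : Fin n) → lookup x i ≢ lookup y i

VSet : ℕ → Set₁
VSet n = Vertex n → Set

-- S induces a subgraph isomorphic to Q_k: an injective map Q_k → Q_n with
-- image exactly S that preserves and reflects adjacency
IsSubcube : ∀ {n} → ℕ → VSet n → Set
IsSubcube {n} k S =
  Σ (Vertex k → Vertex n) λ f → (Injective _≡_ _≡_ f
         × (∀ (a : Vertex k) → S (f a))
         × (∀ (x : Vertex n) → S x → ∃[ a ] f a ≡ x)
         × (∀ (a b : Vertex k) → Adj (f a) (f b) ⇔ Adj a b))

InUnion : ∀ {n} → List (VSet n) → Vertex n → Set₁
InUnion F x = Any (λ S → S x) F

data PairwiseDisjoint {n : ℕ} : List (VSet n) → Set₁ where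
  []  : PairwiseDisjoint Data.List.[]
  _∷_ : ∀ {S F} → All (λ T → ∀ x → S x → T x → Data.Empty.⊥) F →
        PairwiseDisjoint F → PairwiseDisjoint (S Data.List.∷ F)

-- An injective adjacency-preserving map f : Q_k → Q_n sends every edge of direction c to an
-- edge of one fixed direction, axis c: the images of the two opposite edges of a square of Q_k
-- are opposite edges of a square of Q_n.  So a k-subcube S is axis-parallel: its vertices
-- agree off the k axes.  Consequently a vertex u ∉ S has at most one neighbour in S (if
-- (u)^i ∈ S then i is an axis, and then u ∈ S), and if (u)^i, (v)^j ∈ S for symmetric u, v
-- then every coordinate other than i, j is an axis, so n ≤ k + 2.  For k ≤ n − 3 every member
-- of F therefore blocks at most one direction j (in the sense that (u)^j or (v)^j lies in it),
-- and fewer than n members cannot block all n directions.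
module Submission where

open import Defs
open import Data.Nat using (ℕ; _≤_; _+_; _<_; s≤s)
open import Data.Fin using (Fin; zero; suc; _≟_)
open import Data.List using (List; length)
open import Data.List.Relation.Unary.All using (All; []; _∷_)
open import Data.Product using (∃; ∃-syntax; _×_; _,_; proj₁; proj₂)
open import Relation.Nullary using (¬_; Dec; yes; no; contradiction)

open import Level using (Level)
open import Data.Bool using (true; false; not)
open import Data.Bool.Properties using (not-involutive; not-¬; ¬-not) renaming (_≟_ to _≟ᵇ_)
import Data.Nat as ℕ
open import Data.Nat.Properties using (+-comm; +-monoˡ-≤; +-cancelˡ-≤; ≤-trans; <⇒≱)
open import Data.Fin.Properties using (any?; injective⇒≤; ¬∀⟶∃¬)
open import Data.Vec using ([]; _∷_; lookup; replicate)
open import Data.Vec.Properties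
  using (lookup∘updateAt; lookup∘updateAt′; updateAt-updateAt; updateAt-id-local; updateAt-commutes; ≡-dec)
open import Data.Vec.Relation.Binary.Pointwise.Extensional using (ext; Pointwise-≡⇒≡)
import Data.Vec.Functional as Fun
import Data.List as List
open import Data.List.Membership.Propositional using (lose)
open import Data.List.Membership.Propositional.Properties using (∈-lookup)
import Data.List.Relation.Unary.All as All
open import Data.List.Relation.Unary.Any as Any using (Any; index)
open import Data.List.Relation.Unary.Any.Properties using (lookup-index)
import Data.Product as Product
open import Data.Sum using (_⊎_; inj₁; inj₂)
open import Function using (_∘_)
open import Function.Bundles using (Equivalence)
open import Function.Definitions using (Injective)
import Relation.Nullary.Decidable as Dec
open import Relation.Nullary.Decidable using (_⊎-dec_)
open import Relation.Unary using (Pred; Decidable)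
open import Relation.Binary.PropositionalEquality
  using (_≡_; _≢_; refl; sym; trans; cong; subst; module ≡-Reasoning)

private
  variable
    ℓ ℓ′ : Level
    k n : ℕ

covering⇒≤ : ∀ {m} (g : Fin m → Fin n) → (∀ y → ∃[ x ] g x ≡ y) → n ≤ m
covering⇒≤ g cover = injective⇒≤ {f = proj₁ ∘ cover} λ {y} {y′} e →
  trans (sym (proj₂ (cover y))) (trans (cong g e) (proj₂ (cover y′)))

any?-All : ∀ {A : Set ℓ} {P : Pred A ℓ′} {xs} → All (Dec ∘ P) xs → Dec (Any P xs)
any?-All []          = no λ ()
any?-All (p? ∷ ps?) = Dec.map′ Any.fromSum Any.toSum (p? ⊎-dec any?-All ps?)

uncovered-index : ∀ {A : Set ℓ} (R : A → Fin n → Set ℓ′) (xs : List A) → length xs < n →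
                  All (Decidable ∘ R) xs → All (λ x → ∀ {i j} → R x i → R x j → i ≡ j) xs →
                  ∃[ j ] ¬ Any (λ x → R x j) xs
uncovered-index {n = n} R xs |xs|<n R? R-functional =
  ¬∀⟶∃¬ n (λ j → Any (λ x → R x j) xs) covered? (λ cover →
    <⇒≱ |xs|<n (injective⇒≤ (index-injective cover)))
  where
  covered? : ∀ j → Dec (Any (λ x → R x j) xs)
  covered? j = any?-All (All.map (λ Rₓ? → Rₓ? j) R?)
  index-injective : (cover : ∀ j → Any (λ x → R x j) xs) → Injective _≡_ _≡_ (index ∘ cover)
  index-injective cover {i} {j} e = All.lookup R-functional (∈-lookup (index (cover i)))
    (lookup-index (cover i)) (subst (λ t → R (List.lookup xs t) j) (sym e) (lookup-index (cover j)))

lookup-flip : ∀ (x : Vertex n) i → lookup (flip x i) i ≡ not (lookup x i)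
lookup-flip x i = lookup∘updateAt i x

lookup-flip-≢ : ∀ (x : Vertex n) {i p} → p ≢ i → lookup (flip x i) p ≡ lookup x p
lookup-flip-≢ x {i} {p} p≢i = lookup∘updateAt′ p i p≢i x

flip-involutive : ∀ (x : Vertex n) i → flip (flip x i) i ≡ x
flip-involutive x i = trans (updateAt-updateAt i x) (updateAt-id-local i x (not-involutive _))

flip-comm : ∀ (x : Vertex n) i j → flip (flip x i) j ≡ flip (flip x j) i
flip-comm x i j with i ≟ j
... | yes refl = refl
... | no i≢j   = updateAt-commutes j i (i≢j ∘ sym) x

flip-injective : ∀ (x : Vertex n) {i j} → flip x i ≡ flip x j → i ≡ j
flip-injective x {i} {j} e with i ≟ j
... | yes i≡j = i≡j
... | no i≢j  = contradiction (sym flipped) (not-¬ refl)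
  where
  open ≡-Reasoning
  flipped : not (lookup x i) ≡ lookup x i
  flipped = begin
    not (lookup x i)     ≡⟨ lookup-flip x i ⟨
    lookup (flip x i) i  ≡⟨ cong (λ z → lookup z i) e ⟩
    lookup (flip x j) i  ≡⟨ lookup-flip-≢ x i≢j ⟩
    lookup x i           ∎

-- Coordinate i is flipped an odd number of times on the left, so also on the right.
flip-square : ∀ (x : Vertex n) {i j l i′} → flip (flip x i) j ≡ flip (flip x l) i′ →
              i ≢ j → i ≢ l → i ≡ i′
flip-square x {i} {j} {l} {i′} e i≢j i≢l with i ≟ i′
... | yes i≡i′ = i≡i′
... | no i≢i′  = contradiction (sym flipped) (not-¬ refl)
  where
  open ≡-Reasoning
  flipped : not (lookup x i) ≡ lookup x i
  flipped = begin
    not (lookup x i)                 ≡⟨ lookup-flip x i ⟨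
    lookup (flip x i) i              ≡⟨ lookup-flip-≢ (flip x i) i≢j ⟨
    lookup (flip (flip x i) j) i     ≡⟨ cong (λ z → lookup z i) e ⟩
    lookup (flip (flip x l) i′) i    ≡⟨ lookup-flip-≢ (flip x l) i≢i′ ⟩
    lookup (flip x l) i              ≡⟨ lookup-flip-≢ x i≢l ⟩
    lookup x i                       ∎

adj-flip : ∀ (x : Vertex n) i → Adj x (flip x i)
adj-flip x i = i , (λ e → not-¬ refl (trans e (lookup-flip x i))) ,
               (λ p p≢i → sym (lookup-flip-≢ x p≢i))

adj⇒flip : ∀ (x y : Vertex n) → Adj x y → ∃[ i ] y ≡ flip x i
adj⇒flip x y (i , xᵢ≢yᵢ , agree) = i , Pointwise-≡⇒≡ (ext pointwise)
  where
  pointwise : ∀ p → lookup y p ≡ lookup (flip x i) p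
  pointwise p with p ≟ i
  ... | yes refl = trans (¬-not (xᵢ≢yᵢ ∘ sym)) (sym (lookup-flip x i))
  ... | no p≢i   = trans (sym (agree p p≢i)) (sym (lookup-flip-≢ x p≢i))

flip-induction : ∀ (P : Pred (Vertex k) ℓ) → P (replicate k false) →
                 (∀ a c → P a → P (flip a c)) → ∀ a → P a
flip-induction P P₀ step []      = P₀
flip-induction P P₀ step (b ∷ a) = extend b
  where
  P[false∷a] : P (false ∷ a)
  P[false∷a] = flip-induction (P ∘ (false ∷_)) P₀ (λ a c → step (false ∷ a) (suc c)) a
  extend : ∀ b → P (b ∷ a)
  extend false = P[false∷a]
  extend true  = step (false ∷ a) zero P[false∷a]

∃-vertex? : ∀ {Q : Pred (Vertex k) ℓ} → Decidable Q → Dec (∃ Q)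
∃-vertex? {0}                Q? = Dec.map′ ([] ,_) (λ { ([] , q) → q }) (Q? [])
∃-vertex? {ℕ.suc k} {Q = Q} Q? =
  Dec.map′ from to (∃-vertex? (Q? ∘ (false ∷_)) ⊎-dec ∃-vertex? (Q? ∘ (true ∷_)))
  where
  from : ∃ (Q ∘ (false ∷_)) ⊎ ∃ (Q ∘ (true ∷_)) → ∃ Q
  from (inj₁ (a , q)) = false ∷ a , q
  from (inj₂ (a , q)) = true ∷ a , q
  to : ∃ Q → ∃ (Q ∘ (false ∷_)) ⊎ ∃ (Q ∘ (true ∷_))
  to (false ∷ a , q) = inj₁ (a , q)
  to (true ∷ a , q)  = inj₂ (a , q)

module CubeEmbedding (f : Vertex k → Vertex n) (f-injective : Injective _≡_ _≡_ f)
                     (f-adj : ∀ a b → Adj a b → Adj (f a) (f b)) where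

  direction : Vertex k → Fin k → Fin n
  direction a c = proj₁ (adj⇒flip (f a) (f (flip a c)) (f-adj a (flip a c) (adj-flip a c)))

  f-flip-direction : ∀ a c → f (flip a c) ≡ flip (f a) (direction a c)
  f-flip-direction a c = proj₂ (adj⇒flip (f a) (f (flip a c)) (f-adj a (flip a c) (adj-flip a c)))

  direction-unique : ∀ a c {i} → f (flip a c) ≡ flip (f a) i → direction a c ≡ i
  direction-unique a c e = flip-injective (f a) (trans (sym (f-flip-direction a c)) e)

  direction-injective : ∀ a {c d} → direction a c ≡ direction a d → c ≡ d
  direction-injective a {c} {d} e = flip-injective a (f-injective (begin
    f (flip a c)                ≡⟨ f-flip-direction a c ⟩
    flip (f a) (direction a c)  ≡⟨ cong (flip (f a)) e ⟩
    flip (f a) (direction a d)  ≡⟨ f-flip-direction a d ⟨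
    f (flip a d)                ∎))
    where open ≡-Reasoning

  direction-flip-self : ∀ a c → direction (flip a c) c ≡ direction a c
  direction-flip-self a c = direction-unique (flip a c) c (begin
    f (flip (flip a c) c)                 ≡⟨ cong f (flip-involutive a c) ⟩
    f a                                   ≡⟨ flip-involutive (f a) i ⟨
    flip (flip (f a) i) i                 ≡⟨ cong (λ z → flip z i) (f-flip-direction a c) ⟨
    flip (f (flip a c)) i                 ∎)
    where
    open ≡-Reasoning
    i : Fin n
    i = direction a c

  direction-flip : ∀ a c d → direction (flip a d) c ≡ direction a c
  direction-flip a c d with d ≟ c
  ... | yes refl = direction-flip-self a c
  ... | no d≢c   = sym (flip-square (f a) square i≢j′ i≢j)
    where
    open ≡-Reasoning
    i j i′ j′ : Fin n
    i  = direction a c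
    j  = direction a d
    i′ = direction (flip a d) c
    j′ = direction (flip a c) d
    square : flip (flip (f a) i) j′ ≡ flip (flip (f a) j) i′
    square = begin
      flip (flip (f a) i) j′   ≡⟨ cong (λ z → flip z j′) (f-flip-direction a c) ⟨
      flip (f (flip a c)) j′   ≡⟨ f-flip-direction (flip a c) d ⟨
      f (flip (flip a c) d)    ≡⟨ cong f (flip-comm a c d) ⟩
      f (flip (flip a d) c)    ≡⟨ f-flip-direction (flip a d) c ⟩
      flip (f (flip a d)) i′   ≡⟨ cong (λ z → flip z i′) (f-flip-direction a d) ⟩
      flip (flip (f a) j) i′   ∎
    i≢j : i ≢ j
    i≢j i≡j = d≢c (sym (direction-injective a i≡j))
    i≢j′ : i ≢ j′
    i≢j′ i≡j′ = d≢c (direction-injective (flip a c) (trans (sym i≡j′) (sym (direction-flip-self a c))))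

  axis : Fin k → Fin n
  axis = direction (replicate k false)

  f-flip : ∀ a c → f (flip a c) ≡ flip (f a) (axis c)
  f-flip a c = trans (f-flip-direction a c) (cong (flip (f a)) (direction≡axis a))
    where
    direction≡axis : ∀ a → direction a c ≡ axis c
    direction≡axis = flip-induction (λ a → direction a c ≡ axis c) refl
                       (λ a d eq → trans (direction-flip a c d) eq)

  lookup-f-off-axes : ∀ {p} → (∀ c → axis c ≢ p) → ∀ a b → lookup (f a) p ≡ lookup (f b) p
  lookup-f-off-axes {p = p} off a b = trans (≡base a) (sym (≡base b))
    where
    ≡base : ∀ a → lookup (f a) p ≡ lookup (f (replicate k false)) p
    ≡base = flip-induction (λ a → lookup (f a) p ≡ lookup (f (replicate k false)) p) refl
              (λ a c eq → trans (cong (λ z → lookup z p) (f-flip a c))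
                                (trans (lookup-flip-≢ (f a) (off c ∘ sym)) eq))

  module _ {S : VSet n} (f∈S : ∀ a → S (f a)) (S⊆image : ∀ x → S x → ∃[ a ] f a ≡ x) where

    agree-off-axes : ∀ {x y p} → S x → S y → (∀ c → axis c ≢ p) → lookup x p ≡ lookup y p
    agree-off-axes x∈S y∈S off with S⊆image _ x∈S | S⊆image _ y∈S
    ... | a , refl | b , refl = lookup-f-off-axes off a b

    neighbour-unique : ∀ {u i j} → ¬ S u → S (flip u i) → S (flip u j) → i ≡ j
    neighbour-unique {u} {i} {j} u∉S uⁱ∈S uʲ∈S with any? (λ c → axis c ≟ i)
    ... | yes (c , refl) = contradiction u∈S u∉S
      where
      open ≡-Reasoning
      a : Vertex k
      a = proj₁ (S⊆image _ uⁱ∈S)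
      u∈S : S u
      u∈S = subst S (begin
        f (flip a c)           ≡⟨ f-flip a c ⟩
        flip (f a) (axis c)    ≡⟨ cong (λ z → flip z (axis c)) (proj₂ (S⊆image _ uⁱ∈S)) ⟩
        flip (flip u i) i      ≡⟨ flip-involutive u i ⟩
        u                      ∎) (f∈S (flip a c))
    ... | no off-axis with i ≟ j
    ...   | yes i≡j = i≡j
    ...   | no i≢j  = contradiction (sym flipped) (not-¬ refl)
      where
      open ≡-Reasoning
      flipped : not (lookup u i) ≡ lookup u i
      flipped = begin
        not (lookup u i)     ≡⟨ lookup-flip u i ⟨
        lookup (flip u i) i  ≡⟨ agree-off-axes uⁱ∈S uʲ∈S (λ c e → off-axis (c , e)) ⟩
        lookup (flip u j) i  ≡⟨ lookup-flip-≢ u i≢j ⟩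
        lookup u i           ∎

    symmetric-neighbours⇒≤ : ∀ {u v i j} → Symmetric u v → S (flip u i) → S (flip v j) → n ≤ 2 + k
    symmetric-neighbours⇒≤ {u} {v} {i} {j} u⊥v uⁱ∈S vʲ∈S = covering⇒≤ (i Fun.∷ j Fun.∷ axis) covered
      where
      covered : ∀ p → ∃[ q ] (i Fun.∷ j Fun.∷ axis) q ≡ p
      covered p with any? (λ c → axis c ≟ p) | p ≟ i | p ≟ j
      ... | yes (c , e) | _        | _        = suc (suc c) , e
      ... | no _        | yes refl | _        = zero , refl
      ... | no _        | no _     | yes refl = suc zero , refl
      ... | no off-axis | no p≢i   | no p≢j   = contradiction (begin
        lookup u p           ≡⟨ lookup-flip-≢ u p≢i ⟨
        lookup (flip u i) p  ≡⟨ agree-off-axes uⁱ∈S vʲ∈S (λ c e → off-axis (c , e)) ⟩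
        lookup (flip v j) p  ≡⟨ lookup-flip-≢ v p≢j ⟩
        lookup v p           ∎) (u⊥v p)
        where open ≡-Reasoning

Blocks : VSet n → Vertex n → Vertex n → Fin n → Set
Blocks S u v j = S (flip u j) ⊎ S (flip v j)

subcube? : ∀ {S : VSet n} → IsSubcube k S → Decidable S
subcube? {S = S} (f , _ , f∈S , S⊆image , _) x =
  Dec.map′ (λ (a , fa≡x) → subst S fa≡x (f∈S a)) (S⊆image x) (∃-vertex? (λ a → ≡-dec _≟ᵇ_ (f a) x))

blocks-unique : ∀ {S : VSet n} {u v} → k + 3 ≤ n → IsSubcube k S → Symmetric u v → ¬ S u → ¬ S v →
                ∀ {i j} → Blocks S u v i → Blocks S u v j → i ≡ j
blocks-unique {n = n} {k = k} {S} {u} {v} k+3≤n (f , f-injective , f∈S , S⊆image , f-adj) u⊥v u∉S v∉S =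
  unique
  where
  open CubeEmbedding f f-injective (λ a b → Equivalence.from (f-adj a b))
  too-large : ¬ n ≤ 2 + k
  too-large n≤2+k with +-cancelˡ-≤ k 3 2 (≤-trans k+3≤n (subst (n ≤_) (+-comm 2 k) n≤2+k))
  ... | s≤s (s≤s ())
  unique : ∀ {i j} → Blocks S u v i → Blocks S u v j → i ≡ j
  unique (inj₁ uⁱ∈S) (inj₁ uʲ∈S) = neighbour-unique f∈S S⊆image u∉S uⁱ∈S uʲ∈S
  unique (inj₂ vⁱ∈S) (inj₂ vʲ∈S) = neighbour-unique f∈S S⊆image v∉S vⁱ∈S vʲ∈S
  unique (inj₁ uⁱ∈S) (inj₂ vʲ∈S) =
    contradiction (symmetric-neighbours⇒≤ f∈S S⊆image u⊥v uⁱ∈S vʲ∈S) too-large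
  unique (inj₂ vⁱ∈S) (inj₁ uʲ∈S) =
    contradiction (symmetric-neighbours⇒≤ f∈S S⊆image (λ p → u⊥v p ∘ sym) vⁱ∈S uʲ∈S) too-large

lemma3p1 : (m n : ℕ) → m + 3 ≤ n →
    (F : List (VSet n)) → length F + 1 ≤ n → PairwiseDisjoint F →
    All (λ S → ∃[ k ] (k ≤ m × IsSubcube k S)) F →
    (u v : Vertex n) → Symmetric u v → ¬ InUnion F u → ¬ InUnion F v →
    ∃[ j ] (¬ InUnion F (flip u j) × ¬ InUnion F (flip v j))
lemma3p1 m n m+3≤n F |F|+1≤n _ subcubes u v u⊥v u∉⋃F v∉⋃F =
  Product.map₂ (λ unblocked → unblocked ∘ Any.map inj₁ , unblocked ∘ Any.map inj₂)
    (uncovered-index (λ S → Blocks S u v) F |F|<n blocks? blocks-unique-in-F)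
  where
  |F|<n : length F < n
  |F|<n = subst (_≤ n) (+-comm (length F) 1) |F|+1≤n
  blocks? : All (λ S → Decidable (Blocks S u v)) F
  blocks? = All.map (λ (_ , _ , S-subcube) j →
    subcube? S-subcube (flip u j) ⊎-dec subcube? S-subcube (flip v j)) subcubes
  blocks-unique-in-F : All (λ S → ∀ {i j} → Blocks S u v i → Blocks S u v j → i ≡ j) F
  blocks-unique-in-F = All.tabulate λ S∈F → let (k , k≤m , S-subcube) = All.lookup subcubes S∈F in
    blocks-unique (≤-trans (+-monoˡ-≤ 3 k≤m) m+3≤n) S-subcube u⊥v (u∉⋃F ∘ lose S∈F) (v∉⋃F ∘ lose S∈F)
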